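{- A proper set system $S=(E,\mathcal{F})$ is a matroid (that is, $\mathcal{F}$ is the set of bases of a matroid on $E$) if and only if all sets in $\mathcal{F}$ have the same size and $S$ has no minor isomorphic to a set system in $\{T_5*\{a,d\},\ T_6*\{a,d\}\}\cup\{S_{2k}*\{e_1,e_2,\ldots,e_k\}: k\ge 2\}$.
   Context: A set system is a pair $S=(E,\mathcal{F})$ with $E$ finite and $\mathcal{F}$ a collection of subsets of $E$; it is proper if $\mathcal{F}\neq\emptyset$. Isomorphism: a bijection $\phi:E\to E'$ with $A\in\mathcal{F}\iff\phi(A)\in\mathcal{F}'$. For proper $S$ and $e\in E$: $e$ is a loop if no feasible set contains $e$, a coloop if every feasible set contains $e$. If $e$ is not a loop, $S/e=(E-e,\{F-e:e\in F\in\mathcal{F}\})$; if $e$ is not a coloop, $S\backslash e=(E-e,\{F\in\mathcal{F}:e\notin F\})$; if $e$ is a loop or coloop, $S/e$ and $S\backslash e$ are both set equal to whichever was defined. A minor is any set system obtained by a (possibly empty) sequence of such operations. Twist: $S*A=(E,\{F\triangle A:F\in\mathcal{F}\})$. $S_i=(\{e_1,\ldots,e_i\},\{\emptyset,\{e_1,\ldots,e_i\}\})$; $T_5=(\{a,b,c,d\},\{\emptyset,\{a,b\},\{a,b,c,d\}\})$; $T_6=(\{a,b,c,d\},\{\emptyset,\{a,b\},\{a,c\},\{a,b,c,d\}\})$. -}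

module Defs where

open import Data.Nat using (ℕ; zero; suc; _+_; _≤_)
open import Data.Bool using (Bool; true; false; not; _∧_; _∨_; _xor_)
open import Data.Fin using (Fin)
open import Data.Fin.Subset using (Subset; inside; outside; _∈_; _∉_; _∪_; _-_; ⁅_⁆; ∣_∣)
open import Data.Vec using (Vec; []; _∷_; insertAt; zipWith; tabulate; lookup; replicate; _++_)
open import Data.Product using (Σ; ∃; _×_; _,_)
open import Relation.Binary.PropositionalEquality using (_≡_)
open import Relation.Nullary using (¬_)
open import Function.Bundles using (_↔_; Inverse)

-- A set system on the ground set E = Fin n: the family 𝓕 is given by its
-- (decidable) membership predicate.  A ∈ 𝓕  iff  S A ≡ true.
SetSystem : ℕ → Set
SetSystem n = Subset n → Bool

Feasible : {n : ℕ} → SetSystem n → Subset n → Set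
Feasible S A = S A ≡ true

Proper : {n : ℕ} → SetSystem n → Set
Proper S = ∃ λ A → Feasible S A

Loop : {n : ℕ} → SetSystem n → Fin n → Set
Loop S e = ∀ A → Feasible S A → e ∉ A

Coloop : {n : ℕ} → SetSystem n → Fin n → Set
Coloop S e = ∀ A → Feasible S A → e ∈ A

-- S / e  (ground set E - e):  {F - e : e ∈ F ∈ 𝓕}
contract : {n : ℕ} → SetSystem (suc n) → Fin (suc n) → SetSystem n
contract S e A = S (insertAt A e inside)

-- S \ e  (ground set E - e):  {F ∈ 𝓕 : e ∉ F}
delete : {n : ℕ} → SetSystem (suc n) → Fin (suc n) → SetSystem n
delete S e A = S (insertAt A e outside)

-- Minor S M : M is obtained from S by a (possibly empty) sequence of
-- contractions of non-loops and deletions of non-coloops.  (For proper S,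
-- the loop/coloop conventions of the paper give exactly these systems:
-- contracting a loop equals deleting it, which is a non-coloop, and
-- deleting a coloop equals contracting it, which is a non-loop.)
data Minor : {n m : ℕ} → SetSystem n → SetSystem m → Set where
  here : {n : ℕ} {S : SetSystem n} → Minor S S
  con  : {n m : ℕ} {S : SetSystem (suc n)} {M : SetSystem m} (e : Fin (suc n)) →
         ¬ Loop S e → Minor (contract S e) M → Minor S M
  del  : {n m : ℕ} {S : SetSystem (suc n)} {M : SetSystem m} (e : Fin (suc n)) →
         ¬ Coloop S e → Minor (delete S e) M → Minor S M

image : {n m : ℕ} → Fin n ↔ Fin m → Subset n → Subset m
image φ A = tabulate (λ y → lookup A (Inverse.from φ y))

Isomorphic : {n m : ℕ} → SetSystem n → SetSystem m → Set
Isomorphic {n} {m} S T = Σ (Fin n ↔ Fin m) λ φ → ∀ A → S A ≡ T (image φ A)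

-- twist S * X = (E, {F △ X : F ∈ 𝓕});  G ∈ 𝓕 △ X  iff  G △ X ∈ 𝓕
_△_ : {n : ℕ} → Subset n → Subset n → Subset n
A △ B = zipWith _xor_ A B

twist : {n : ℕ} → SetSystem n → Subset n → SetSystem n
twist S X G = S (G △ X)

allOut : {n : ℕ} → Subset n → Bool
allOut []       = true
allOut (x ∷ xs) = not x ∧ allOut xs

allIn : {n : ℕ} → Subset n → Bool
allIn []       = true
allIn (x ∷ xs) = x ∧ allIn xs

-- S_i = ({e_1,…,e_i}, {∅, {e_1,…,e_i}})   (e_j = j-1 : Fin i)
Sys : (i : ℕ) → SetSystem i
Sys i A = allOut A ∨ allIn A

-- ground set {a,b,c,d} = Fin 4 with a = 0, b = 1, c = 2, d = 3
T5 : SetSystem 4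
T5 (outside ∷ outside ∷ outside ∷ outside ∷ []) = true
T5 (inside  ∷ inside  ∷ outside ∷ outside ∷ []) = true
T5 (inside  ∷ inside  ∷ inside  ∷ inside  ∷ []) = true
T5 _ = false

T6 : SetSystem 4
T6 (outside ∷ outside ∷ outside ∷ outside ∷ []) = true
T6 (inside  ∷ inside  ∷ outside ∷ outside ∷ []) = true
T6 (inside  ∷ outside ∷ inside  ∷ outside ∷ []) = true
T6 (inside  ∷ inside  ∷ inside  ∷ inside  ∷ []) = true
T6 _ = false

setAD : Subset 4
setAD = inside ∷ outside ∷ outside ∷ inside ∷ []

firstHalf : (k : ℕ) → Subset (k + k)
firstHalf k = replicate k inside ++ replicate k outside

data Excluded : {m : ℕ} → SetSystem m → Set where
  exT5 : Excluded (twist T5 setAD)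
  exT6 : Excluded (twist T6 setAD)
  exS  : (k : ℕ) → 2 ≤ k → Excluded (twist (Sys (k + k)) (firstHalf k))

HasExcludedMinor : {n : ℕ} → SetSystem n → Set
HasExcludedMinor {n} S =
  Σ ℕ λ m → Σ (SetSystem m) λ M → Σ ℕ λ p → Σ (SetSystem p) λ T →
    Minor S M × Excluded T × Isomorphic M T

Equicardinal : {n : ℕ} → SetSystem n → Set
Equicardinal S = ∀ A B → Feasible S A → Feasible S B → ∣ A ∣ ≡ ∣ B ∣

IsMatroid : {n : ℕ} → SetSystem n → Set
IsMatroid S =
  Proper S ×
  (∀ A B → Feasible S A → Feasible S B → ∀ x → x ∈ A → x ∉ B →
     ∃ λ y → y ∈ B × y ∉ A × Feasible S ((A - x) ∪ ⁅ y ⁆))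

-- A matroid's bases satisfy the exchange axiom, which passes to minors and isomorphic copies,
-- fails in each excluded system, and forces equal cardinalities (an exchange shrinks ∣ A ─ B ∣).
-- Conversely, let exchange fail for x ∈ A ∖ B in an equicardinal S, by induction on the ground
-- set. If A and B agree at some e, contracting or deleting e keeps the failure. Otherwise B = ∁ A,
-- and every failure whose sets agree somewhere already gives an excluded minor. Then every other
-- feasible set has the form B - y + x, and A has a second element a (else A - x + y = B for
-- B = {y}). If some B - y + x is feasible, exchanging a out of A into it confines the ground set
-- to four points carrying T5 * {a,d} or T6 * {a,d}; otherwise A and B are the only feasible sets
-- and S is S_2k * {e_1, ..., e_k} with k = ∣ A ∣ ≥ 2.

module Submission where

open import Defs
open import Data.Nat using (ℕ; zero; suc; pred; _+_; _≤_; _<ᵇ_; z≤n; s≤s)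
open import Data.Nat.Properties using (+-suc; m≤m+n)
open import Data.Bool using (Bool; true; false; not; _∧_; _∨_)
open import Data.Bool.Properties using (not-involutive; not-¬; not-injective; ⇔→≡; ¬-not; ∧-zeroʳ; ∧-identityʳ; ∨-zeroʳ; ∨-identityʳ) renaming (_≟_ to _≟ᵇ_)
open import Data.Fin using (Fin; zero; suc; punchIn; _≟_; toℕ; fromℕ<; cast)
import Data.Fin.Permutation as Perm
open import Data.Fin.Properties using (toℕ-cast; toℕ-fromℕ<; any?; suc-injective; punchIn-injective; punchInᵢ≢i; punchIn-punchOut)
open import Data.Fin.Subset using (Subset; _∈_; _∉_; inside; outside; _─_; _-_; _∪_; ⁅_⁆; ∣_∣; ∁)
open import Data.Fin.Subset.Properties using (anySubset?)
open import Data.Vec using ([]; _∷_; lookup; insertAt; replicate; _++_; removeAt)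
open import Data.Vec.Properties using (lookup-map; insertAt-removeAt; ≡-dec; lookup∘tabulate; lookup⇒[]=; []=⇒lookup; tabulate∘lookup; tabulate-cong; lookup-zipWith; lookup-replicate; insertAt-lookup; insertAt-punchIn)
open import Data.Product using (Σ; ∃; _×_; _,_; proj₁; proj₂)
open import Data.Sum using (_⊎_; inj₁; inj₂; [_,_]′)
open import Data.Empty using (⊥; ⊥-elim)
open import Function using (_∘_; id)
open import Data.List using (List; []; _∷_)
import Data.List as List
open import Data.List.Relation.Unary.Any using (here; there)
import Data.List.Relation.Unary.Any as Any
open import Data.List.Membership.Propositional using () renaming (_∈_ to _∈ˡ_)
open import Data.List.Membership.Propositional.Properties using (∈-map⁺; ∈-map⁻)
open import Function.Bundles using (_↔_; Inverse; Equivalence; _⇔_; mk⇔; mk↔ₛ′)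
open import Function.Properties.Inverse using (↔-sym)
open import Relation.Binary.PropositionalEquality
open import Relation.Nullary using (¬_; Dec; yes; no; does)
open import Relation.Nullary.Decidable using (¬?; decidable-stable; _×-dec_; dec-true; dec-false)

private
  variable
    n m : ℕ

lookup-ext : {u v : Subset n} → (∀ i → lookup u i ≡ lookup v i) → u ≡ v
lookup-ext {u = u} {v} u≗v =
  trans (sym (tabulate∘lookup u)) (trans (tabulate-cong u≗v) (tabulate∘lookup v))

bool-absurd : {b : Bool} {A : Set} → b ≡ true → b ≡ false → A
bool-absurd refl ()

∧-not≡true : {a b : Bool} → a ∧ not b ≡ true → a ≡ true × b ≡ false
∧-not≡true {true} {false} _ = refl , refl

≢-by-lookup : {K : Subset n} {i j : Fin n} → lookup K i ≡ true → lookup K j ≡ false → i ≢ j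
≢-by-lookup Ki Kj refl = bool-absurd Ki Kj

lookup-⁅⁆ : (y i : Fin n) → lookup ⁅ y ⁆ i ≡ does (i ≟ y)
lookup-⁅⁆ zero    zero    = refl
lookup-⁅⁆ zero    (suc i) = lookup-replicate i false
lookup-⁅⁆ (suc y) zero    = refl
lookup-⁅⁆ (suc y) (suc i) = lookup-⁅⁆ y i

lookup-─ : (p q : Subset n) (i : Fin n) → lookup (p ─ q) i ≡ lookup p i ∧ not (lookup q i)
lookup-─ (a ∷ p) (true  ∷ q) zero    = sym (∧-zeroʳ a)
lookup-─ (a ∷ p) (false ∷ q) zero    = sym (∧-identityʳ a)
lookup-─ (_ ∷ p) (_     ∷ q) (suc i) = lookup-─ p q i

lookup-remove-self : (A : Subset n) (x : Fin n) → lookup (A - x) x ≡ false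
lookup-remove-self A x rewrite lookup-─ A ⁅ x ⁆ x | lookup-⁅⁆ x x | dec-true (x ≟ x) refl = ∧-zeroʳ _

lookup-remove-other : (A : Subset n) {x j : Fin n} → j ≢ x → lookup (A - x) j ≡ lookup A j
lookup-remove-other A {x} {j} j≢x rewrite lookup-─ A ⁅ x ⁆ j | lookup-⁅⁆ x j | dec-false (j ≟ x) j≢x =
  ∧-identityʳ _

lookup-remove⇒lookup : (A : Subset n) {x a : Fin n} → lookup (A - x) a ≡ true → lookup A a ≡ true × a ≢ x
lookup-remove⇒lookup A {x} {a} a∈A-x =
  proj₁ (∧-not≡true (trans (sym (lookup-─ A ⁅ x ⁆ a)) a∈A-x)) , ≢-by-lookup {K = A - x} a∈A-x (lookup-remove-self A x)

_≟ˢ_ : (P Q : Subset n) → Dec (P ≡ Q)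
_≟ˢ_ = ≡-dec _≟ᵇ_

Agree : Subset n → Subset n → Set
Agree P Q = ∃ λ e → lookup P e ≡ lookup Q e

agree-or-complement : (P Q : Subset n) → Agree P Q ⊎ (∀ i → lookup Q i ≡ not (lookup P i))
agree-or-complement P Q with any? (λ e → lookup P e ≟ᵇ lookup Q e)
... | yes agree    = inj₁ agree
... | no disagree = inj₂ λ i → ¬-not (λ Qi≡Pi → disagree (i , sym Qi≡Pi))

exchange : Subset n → Fin n → Fin n → Subset n
exchange A x y = (A - x) ∪ ⁅ y ⁆

lookup-exchange : (A : Subset n) (x y i : Fin n) →
  lookup (exchange A x y) i ≡ (lookup A i ∧ not (does (i ≟ x))) ∨ does (i ≟ y)
lookup-exchange A x y i = begin
  lookup ((A - x) ∪ ⁅ y ⁆) i               ≡⟨ lookup-zipWith _∨_ i (A - x) ⁅ y ⁆ ⟩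
  lookup (A - x) i ∨ lookup ⁅ y ⁆ i         ≡⟨ cong₂ _∨_ (lookup-─ A ⁅ x ⁆ i) (lookup-⁅⁆ y i) ⟩
  (lookup A i ∧ not (lookup ⁅ x ⁆ i)) ∨ _   ≡⟨ cong (λ b → (lookup A i ∧ not b) ∨ does (i ≟ y)) (lookup-⁅⁆ x i) ⟩
  (lookup A i ∧ not (does (i ≟ x))) ∨ does (i ≟ y) ∎
  where open ≡-Reasoning

lookup-exchange-new : (A : Subset n) (x y : Fin n) → lookup (exchange A x y) y ≡ true
lookup-exchange-new A x y rewrite lookup-exchange A x y y | dec-true (y ≟ y) refl = ∨-zeroʳ _

lookup-exchange-old : (A : Subset n) {x y : Fin n} → x ≢ y → lookup (exchange A x y) x ≡ false
lookup-exchange-old A {x} {y} x≢y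
  rewrite lookup-exchange A x y x | dec-true (x ≟ x) refl | dec-false (x ≟ y) x≢y =
  trans (∨-identityʳ _) (∧-zeroʳ _)

lookup-exchange-other : (A : Subset n) {x y i : Fin n} → i ≢ x → i ≢ y →
  lookup (exchange A x y) i ≡ lookup A i
lookup-exchange-other A {x} {y} {i} i≢x i≢y
  rewrite lookup-exchange A x y i | dec-false (i ≟ x) i≢x | dec-false (i ≟ y) i≢y =
  trans (∨-identityʳ _) (∧-identityʳ _)

lookup-exchange-≢new : (A : Subset n) {x y j : Fin n} → j ≢ y → lookup (exchange A x y) j ≡ lookup (A - x) j
lookup-exchange-≢new A {x} {y} {j} j≢y rewrite lookup-zipWith _∨_ j (A - x) ⁅ y ⁆ | lookup-⁅⁆ y j | dec-false (j ≟ y) j≢y =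
  ∨-identityʳ _

exchange-exchange : (K : Subset n) {x y : Fin n} → lookup K x ≡ true → lookup K y ≡ false →
  exchange (exchange K x y) y x ≡ K
exchange-exchange K {x} {y} Kx Ky = lookup-ext pointwise
  where
  pointwise : ∀ i → lookup (exchange (exchange K x y) y x) i ≡ lookup K i
  pointwise i with i ≟ x | i ≟ y
  ... | yes refl | _        = trans (lookup-exchange-new (exchange K i y) y i) (sym Kx)
  ... | no _     | yes refl = trans (lookup-exchange-old (exchange K x i) (≢-by-lookup {K = K} Kx Ky ∘ sym)) (sym Ky)
  ... | no i≢x   | no i≢y   = trans (lookup-exchange-other (exchange K x y) i≢y i≢x) (lookup-exchange-other K i≢x i≢y)

exchange-≡-cover : {A B : Subset n} → (∀ i → lookup B i ≡ not (lookup A i)) → {a z y x : Fin n} →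
  exchange A a z ≡ exchange B y x → ∀ i → i ≡ a ⊎ i ≡ z ⊎ i ≡ y ⊎ i ≡ x
exchange-≡-cover {A = A} {B} B≗∁A {a} {z} {y} {x} H≡H′ i with i ≟ a | i ≟ z | i ≟ y | i ≟ x
... | yes i≡a | _       | _       | _       = inj₁ i≡a
... | no _    | yes i≡z | _       | _       = inj₂ (inj₁ i≡z)
... | no _    | no _    | yes i≡y | _       = inj₂ (inj₂ (inj₁ i≡y))
... | no _    | no _    | no _    | yes i≡x = inj₂ (inj₂ (inj₂ i≡x))
... | no i≢a  | no i≢z  | no i≢y  | no i≢x  = ⊥-elim (not-¬ refl (begin
  lookup A i                   ≡⟨ lookup-exchange-other A i≢a i≢z ⟨
  lookup (exchange A a z) i    ≡⟨ cong (λ C → lookup C i) H≡H′ ⟩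
  lookup (exchange B y x) i    ≡⟨ lookup-exchange-other B i≢y i≢x ⟩
  lookup B i                   ≡⟨ B≗∁A i ⟩
  not (lookup A i)             ∎))
  where open ≡-Reasoning

∣p∣≡suc∣q∣ : (p q : Subset n) (i : Fin n) → lookup p i ≡ true → lookup q i ≡ false →
  (∀ j → j ≢ i → lookup p j ≡ lookup q j) → ∣ p ∣ ≡ suc ∣ q ∣
∣p∣≡suc∣q∣ (_ ∷ p) (_ ∷ q) zero refl refl p≗q = cong (suc ∘ ∣_∣) (lookup-ext {u = p} {q} (λ j → p≗q (suc j) λ ()))
∣p∣≡suc∣q∣ (a ∷ p) (b ∷ q) (suc i) pi qi p≗q with p≗q zero (λ ())
... | refl with a
...   | true  = cong suc (∣p∣≡suc∣q∣ p q i pi qi (λ j j≢i → p≗q (suc j) (j≢i ∘ suc-injective)))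
...   | false = ∣p∣≡suc∣q∣ p q i pi qi (λ j j≢i → p≗q (suc j) (j≢i ∘ suc-injective))

∣p∣≡0⇒∉ : (p : Subset n) → ∣ p ∣ ≡ 0 → ∀ i → lookup p i ≡ false
∣p∣≡0⇒∉ (false ∷ p) eq zero    = refl
∣p∣≡0⇒∉ (false ∷ p) eq (suc i) = ∣p∣≡0⇒∉ p eq i

∣p∣≡suc⇒∈ : (p : Subset n) {k : ℕ} → ∣ p ∣ ≡ suc k → ∃ λ i → lookup p i ≡ true
∣p∣≡suc⇒∈ (true  ∷ p) _  = zero , refl
∣p∣≡suc⇒∈ (false ∷ p) eq = let i , pi = ∣p∣≡suc⇒∈ p eq in suc i , pi

∣p∣≡suc∣p-x∣ : (p : Subset n) {x : Fin n} → lookup p x ≡ true → ∣ p ∣ ≡ suc ∣ p - x ∣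
∣p∣≡suc∣p-x∣ p {x} px = ∣p∣≡suc∣q∣ p (p - x) x px (lookup-remove-self p x) (λ j j≢x → sym (lookup-remove-other p j≢x))

2≤∣p∣ : (p : Subset n) {x a : Fin n} → lookup p x ≡ true → lookup (p - x) a ≡ true → 2 ≤ ∣ p ∣
2≤∣p∣ p {x} px a∈p-x = subst (2 ≤_) (sym (trans (∣p∣≡suc∣p-x∣ p px) (cong suc (∣p∣≡suc∣p-x∣ (p - x) a∈p-x)))) (s≤s (s≤s z≤n))

∣exchange∣ : (A : Subset n) {x y : Fin n} → lookup A x ≡ true → lookup A y ≡ false →
  ∣ exchange A x y ∣ ≡ ∣ A ∣
∣exchange∣ A {x} {y} Ax Ay = trans
  (∣p∣≡suc∣q∣ (exchange A x y) (A - x) y (lookup-exchange-new A x y) (trans (lookup-remove-other A y≢x) Ay)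
    (λ j → lookup-exchange-≢new A))
  (sym (∣p∣≡suc∣q∣ A (A - x) x Ax (lookup-remove-self A x) (λ j j≢x → sym (lookup-remove-other A j≢x))))
  where
  y≢x : y ≢ x
  y≢x refl = bool-absurd Ax Ay

∣─∣-exchange : (A B : Subset n) {x y : Fin n} → lookup A x ≡ true → lookup B x ≡ false →
  lookup B y ≡ true → lookup A y ≡ false → ∣ A ─ B ∣ ≡ suc ∣ exchange A x y ─ B ∣
∣─∣-exchange A B {x} {y} Ax Bx By Ay = ∣p∣≡suc∣q∣ (A ─ B) (exchange A x y ─ B) x
  (trans (lookup-─ A B x) (cong₂ (λ a b → a ∧ not b) Ax Bx))
  (trans (lookup-─ (exchange A x y) B x) (cong (λ a → a ∧ not (lookup B x)) (lookup-exchange-old A x≢y)))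
  agree
  where
  x≢y : x ≢ y
  x≢y refl = bool-absurd By Bx
  agree : ∀ j → j ≢ x → lookup (A ─ B) j ≡ lookup (exchange A x y ─ B) j
  agree j j≢x with j ≟ y
  ... | yes refl = trans (lookup-─ A B j) (trans (cong₂ (λ a b → a ∧ not b) Ay By)
                     (sym (trans (lookup-─ (exchange A x j) B j) (cong₂ (λ a b → a ∧ not b) (lookup-exchange-new A x j) By))))
  ... | no j≢y   = trans (lookup-─ A B j) (sym (trans (lookup-─ (exchange A x y) B j)
                     (cong (λ a → a ∧ not (lookup B j)) (lookup-exchange-other A j≢x j≢y))))

-- Single-element minors

data PunchInView (e : Fin (suc n)) : Fin (suc n) → Set where
  at      : PunchInView e e
  punched : (j : Fin n) → PunchInView e (punchIn e j)

punchInView : (e i : Fin (suc n)) → PunchInView e i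
punchInView e i with e ≟ i
... | yes refl = at
... | no e≢i   = subst (PunchInView e) (punchIn-punchOut e≢i) (punched _)

does-punchIn-≟ : (e : Fin (suc n)) (j k : Fin n) → does (punchIn e j ≟ punchIn e k) ≡ does (j ≟ k)
does-punchIn-≟ e j k with j ≟ k
... | yes refl = dec-true (punchIn e j ≟ punchIn e j) refl
... | no j≢k   = dec-false (punchIn e j ≟ punchIn e k) (j≢k ∘ punchIn-injective e j k)

insertAt-exchange : (A : Subset n) (e : Fin (suc n)) (b : Bool) (x y : Fin n) →
  insertAt (exchange A x y) e b ≡ exchange (insertAt A e b) (punchIn e x) (punchIn e y)
insertAt-exchange {n} A e b x y = lookup-ext pointwise
  where
  open ≡-Reasoning
  A⁺ : Subset (suc n)
  A⁺ = insertAt A e b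

  pointwise : ∀ i → lookup (insertAt (exchange A x y) e b) i ≡ lookup (exchange A⁺ (punchIn e x) (punchIn e y)) i
  pointwise i with punchInView e i
  ... | at = begin
    lookup (insertAt (exchange A x y) e b) e          ≡⟨ insertAt-lookup (exchange A x y) e b ⟩
    b                                                  ≡⟨ insertAt-lookup A e b ⟨
    lookup A⁺ e                                        ≡⟨ lookup-exchange-other A⁺ (punchInᵢ≢i e x ∘ sym) (punchInᵢ≢i e y ∘ sym) ⟨
    lookup (exchange A⁺ (punchIn e x) (punchIn e y)) e ∎
  ... | punched j = begin
    lookup (insertAt (exchange A x y) e b) (punchIn e j) ≡⟨ insertAt-punchIn (exchange A x y) e b j ⟩
    lookup (exchange A x y) j                            ≡⟨ lookup-exchange A x y j ⟩
    (lookup A j ∧ not (does (j ≟ x))) ∨ does (j ≟ y)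
      ≡⟨ cong₂ _∨_ (cong₂ (λ a c → a ∧ not c) (insertAt-punchIn A e b j) (does-punchIn-≟ e j x))
                   (does-punchIn-≟ e j y) ⟨
    (lookup A⁺ (punchIn e j) ∧ not (does (punchIn e j ≟ punchIn e x))) ∨ does (punchIn e j ≟ punchIn e y)
      ≡⟨ lookup-exchange A⁺ (punchIn e x) (punchIn e y) (punchIn e j) ⟨
    lookup (exchange A⁺ (punchIn e x) (punchIn e y)) (punchIn e j) ∎

-- pin S e true is the contraction S / e and pin S e false the deletion S \ e.
pin : SetSystem (suc n) → Fin (suc n) → Bool → SetSystem n
pin S e b C = S (insertAt C e b)

minor-pin : (S : SetSystem (suc n)) (e : Fin (suc n)) {A : Subset (suc n)} → Feasible S A →
  Minor S (pin S e (lookup A e))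
minor-pin S e {A} fA with lookup A e in Ae
... | true  = con e (λ loop → loop A fA (lookup⇒[]= e A Ae)) here
... | false = del e (λ coloop → bool-absurd ([]=⇒lookup (coloop A fA)) Ae) here

minor-trans : {S : SetSystem n} {M : SetSystem m} {p : ℕ} {N : SetSystem p} →
  Minor S M → Minor M N → Minor S N
minor-trans here           M≼N = M≼N
minor-trans (con e nl S≼M) M≼N = con e nl (minor-trans S≼M M≼N)
minor-trans (del e nc S≼M) M≼N = del e nc (minor-trans S≼M M≼N)

hasExcludedMinor-minor : {S : SetSystem n} {M : SetSystem m} →
  Minor S M → HasExcludedMinor M → HasExcludedMinor S
hasExcludedMinor-minor S≼M (_ , N , _ , T , M≼N , excluded , N≅T) =
  _ , N , _ , T , minor-trans S≼M M≼N , excluded , N≅T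

∣insertAt∣ : (A : Subset n) (e : Fin (suc n)) (b : Bool) → ∣ insertAt A e b ∣ ≡ ∣ b ∷ A ∣
∣insertAt∣ A       zero    b     = refl
∣insertAt∣ (a ∷ A) (suc e) true  with a
... | true  = cong suc (∣insertAt∣ A e true)
... | false = ∣insertAt∣ A e true
∣insertAt∣ (a ∷ A) (suc e) false with a
... | true  = cong suc (∣insertAt∣ A e false)
... | false = ∣insertAt∣ A e false

equicardinal-pin : (S : SetSystem (suc n)) (e : Fin (suc n)) (b : Bool) → Equicardinal S → Equicardinal (pin S e b)
equicardinal-pin S e b equi A C fA fC = cancel b
  (trans (sym (∣insertAt∣ A e b)) (trans (equi _ _ fA fC) (∣insertAt∣ C e b)))
  where
  cancel : ∀ b → ∣ b ∷ A ∣ ≡ ∣ b ∷ C ∣ → ∣ A ∣ ≡ ∣ C ∣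
  cancel true  = cong pred
  cancel false = λ eq → eq

-- Images and isomorphisms

module _ (φ : Fin n ↔ Fin m) where
  open Inverse φ using (to; from; strictlyInverseˡ; strictlyInverseʳ)

  lookup-image : (C : Subset n) (j : Fin m) → lookup (image φ C) j ≡ lookup C (from j)
  lookup-image C = lookup∘tabulate (lookup C ∘ from)

  image-image⁻¹ : (v : Subset m) → image φ (image (↔-sym φ) v) ≡ v
  image-image⁻¹ v = lookup-ext λ j → begin
    lookup (image φ (image (↔-sym φ) v)) j ≡⟨ lookup-image (image (↔-sym φ) v) j ⟩
    lookup (image (↔-sym φ) v) (from j)     ≡⟨ lookup∘tabulate (lookup v ∘ to) (from j) ⟩
    lookup v (to (from j))                  ≡⟨ cong (lookup v) (strictlyInverseˡ j) ⟩
    lookup v j                              ∎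
    where open ≡-Reasoning

  image-injective : {C D : Subset n} → image φ C ≡ image φ D → C ≡ D
  image-injective {C} {D} eq = lookup-ext λ i → begin
    lookup C i                  ≡⟨ cong (lookup C) (strictlyInverseʳ i) ⟨
    lookup C (from (to i))      ≡⟨ lookup-image C (to i) ⟨
    lookup (image φ C) (to i)   ≡⟨ cong (λ E → lookup E (to i)) eq ⟩
    lookup (image φ D) (to i)   ≡⟨ lookup-image D (to i) ⟩
    lookup D (from (to i))      ≡⟨ cong (lookup D) (strictlyInverseʳ i) ⟩
    lookup D i                  ∎
    where open ≡-Reasoning

  does-≟-from : (j : Fin m) (x : Fin n) → does (from j ≟ x) ≡ does (j ≟ to x)
  does-≟-from j x with from j ≟ x
  ... | yes refl = sym (dec-true (j ≟ to (from j)) (sym (strictlyInverseˡ j)))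
  ... | no fj≢x  = sym (dec-false (j ≟ to x) λ j≡tx → fj≢x (trans (cong from j≡tx) (strictlyInverseʳ x)))

  image-exchange : (C : Subset n) (x y : Fin n) → image φ (exchange C x y) ≡ exchange (image φ C) (to x) (to y)
  image-exchange C x y = lookup-ext λ j → begin
    lookup (image φ (exchange C x y)) j                       ≡⟨ lookup-image (exchange C x y) j ⟩
    lookup (exchange C x y) (from j)                          ≡⟨ lookup-exchange C x y (from j) ⟩
    (lookup C (from j) ∧ not (does (from j ≟ x))) ∨ does (from j ≟ y)
      ≡⟨ cong₂ _∨_ (cong₂ (λ a c → a ∧ not c) (sym (lookup-image C j)) (does-≟-from j x)) (does-≟-from j y) ⟩
    (lookup (image φ C) j ∧ not (does (j ≟ to x))) ∨ does (j ≟ to y)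
      ≡⟨ lookup-exchange (image φ C) (to x) (to y) j ⟨
    lookup (exchange (image φ C) (to x) (to y)) j              ∎
    where open ≡-Reasoning

image-∁ : (φ : Fin n ↔ Fin m) (C : Subset n) → image φ (∁ C) ≡ ∁ (image φ C)
image-∁ φ C = lookup-ext λ j → begin
  lookup (image φ (∁ C)) j     ≡⟨ lookup-image φ (∁ C) j ⟩
  lookup (∁ C) (from j)        ≡⟨ lookup-map (from j) not C ⟩
  not (lookup C (from j))      ≡⟨ cong not (lookup-image φ C j) ⟨
  not (lookup (image φ C) j)   ≡⟨ lookup-map j not (image φ C) ⟨
  lookup (∁ (image φ C)) j     ∎
  where
  open Inverse φ using (from)
  open ≡-Reasoning

Enumerates : SetSystem n → List (Subset n) → Set
Enumerates S Cs = ∀ C → Feasible S C ⇔ C ∈ˡ Cs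

isomorphic-by-enumeration : (φ : Fin n ↔ Fin m) {S : SetSystem n} {T : SetSystem m} (Cs : List (Subset n)) →
  Enumerates S Cs → Enumerates T (List.map (image φ) Cs) → Isomorphic S T
isomorphic-by-enumeration φ Cs enumS enumT = φ , λ C → ⇔→≡ (mk⇔
  (λ fC → Equivalence.from (enumT (image φ C)) (∈-map⁺ (image φ) (Equivalence.to (enumS C) fC)))
  (λ fφC → let D , D∈Cs , φC≡φD = ∈-map⁻ (image φ) (Equivalence.to (enumT (image φ C)) fφC)
           in Equivalence.from (enumS C) (subst (_∈ˡ Cs) (sym (image-injective φ φC≡φD)) D∈Cs)))

↔-from-injective-cover : (d : Fin m → Fin n) → (∀ {j k} → d j ≡ d k → j ≡ k) → (∀ i → ∃ λ j → d j ≡ i) →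
  Fin n ↔ Fin m
↔-from-injective-cover d injective cover =
  mk↔ₛ′ (proj₁ ∘ cover) d (λ j → injective (proj₂ (cover (d j)))) (proj₂ ∘ cover)

<ᵇ-irrefl : ∀ p → (p <ᵇ p) ≡ false
<ᵇ-irrefl zero    = refl
<ᵇ-irrefl (suc p) = <ᵇ-irrefl p

punchIn-<ᵇ : ∀ {N} (c : Fin (suc N)) (j : Fin N) → (toℕ (punchIn c j) <ᵇ toℕ c) ≡ (toℕ j <ᵇ toℕ c)
punchIn-<ᵇ zero    j       = refl
punchIn-<ᵇ (suc c) zero    = refl
punchIn-<ᵇ (suc c) (suc j) = punchIn-<ᵇ c j

partition : (A : Subset n) → Σ (Fin n ↔ Fin (∣ A ∣ + ∣ ∁ A ∣)) λ π →
  ∀ i → lookup A i ≡ (toℕ (Inverse.to π i) <ᵇ ∣ A ∣)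
partition []                = Perm.id , λ ()
partition (true ∷ A)        = let π , h = partition A in Perm.lift₀ π , λ { zero → refl ; (suc i) → h i }
partition {suc n} (false ∷ A) = let π , h = partition A in ρ π Perm.∘ₚ Perm.cast-id (sym (+-suc p q)) , position π h
  where
  p q : ℕ
  p = ∣ A ∣
  q = ∣ ∁ A ∣
  c : Fin (suc (p + q))
  c = fromℕ< (s≤s (m≤m+n p q))
  toℕ-c : toℕ c ≡ p
  toℕ-c = toℕ-fromℕ< (s≤s (m≤m+n p q))
  ρ : Fin n ↔ Fin (p + q) → Fin (suc n) ↔ Fin (suc (p + q))
  ρ = Perm.insert zero c
  position : (π : Fin n ↔ Fin (p + q)) → (∀ i → lookup A i ≡ (toℕ (Inverse.to π i) <ᵇ p)) →
    ∀ i → lookup (false ∷ A) i ≡ (toℕ (cast (sym (+-suc p q)) (Inverse.to (ρ π) i)) <ᵇ p)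
  position π h zero = sym (begin
    toℕ (cast _ c) <ᵇ p ≡⟨ cong (_<ᵇ p) (trans (toℕ-cast _ c) toℕ-c) ⟩
    p <ᵇ p              ≡⟨ <ᵇ-irrefl p ⟩
    false               ∎)
    where open ≡-Reasoning
  position π h (suc i) = sym (begin
    toℕ (cast _ (Inverse.to (ρ π) (suc i))) <ᵇ p  ≡⟨ cong (_<ᵇ p) (toℕ-cast _ (Inverse.to (ρ π) (suc i))) ⟩
    toℕ (Inverse.to (ρ π) (suc i)) <ᵇ p            ≡⟨ cong (λ k → toℕ k <ᵇ p) (Perm.insert-punchIn zero c π i) ⟩
    toℕ (punchIn c (Inverse.to π i)) <ᵇ p          ≡⟨ subst (λ t → (toℕ (punchIn c (Inverse.to π i)) <ᵇ t) ≡ (toℕ (Inverse.to π i) <ᵇ t))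
                                                         toℕ-c (punchIn-<ᵇ c (Inverse.to π i)) ⟩
    toℕ (Inverse.to π i) <ᵇ p                      ≡⟨ h i ⟨
    lookup A i                                     ∎)
    where open ≡-Reasoning

lookup-firstHalf : (k m : ℕ) (j : Fin (k + m)) → lookup (replicate k inside ++ replicate m outside) j ≡ (toℕ j <ᵇ k)
lookup-firstHalf zero    m j       = lookup-replicate j false
lookup-firstHalf (suc k) m zero    = refl
lookup-firstHalf (suc k) m (suc j) = lookup-firstHalf k m j

partition-balanced : (A : Subset n) → ∣ ∁ A ∣ ≡ ∣ A ∣ →
  Σ (Fin n ↔ Fin (∣ A ∣ + ∣ A ∣)) λ π → image π A ≡ firstHalf ∣ A ∣
partition-balanced A balanced with partition A
... | π , h rewrite balanced = π , lookup-ext λ j → begin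
  lookup (image π A) j                 ≡⟨ lookup-image π A j ⟩
  lookup A (from j)                    ≡⟨ h (from j) ⟩
  toℕ (to (from j)) <ᵇ ∣ A ∣           ≡⟨ cong (λ k → toℕ k <ᵇ ∣ A ∣) (strictlyInverseˡ j) ⟩
  toℕ j <ᵇ ∣ A ∣                       ≡⟨ lookup-firstHalf ∣ A ∣ ∣ A ∣ j ⟨
  lookup (firstHalf ∣ A ∣) j           ∎
  where
  open Inverse π using (to; from; strictlyInverseˡ)
  open ≡-Reasoning

-- The excluded set systems

allOut-△⇒≡ : (v X : Subset m) → allOut (v △ X) ≡ true → v ≡ X
allOut-△⇒≡ []          []          _ = refl
allOut-△⇒≡ (true  ∷ v) (true  ∷ X) h = cong (true ∷_) (allOut-△⇒≡ v X h)
allOut-△⇒≡ (false ∷ v) (false ∷ X) h = cong (false ∷_) (allOut-△⇒≡ v X h)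
allOut-△⇒≡ (true  ∷ v) (false ∷ X) ()
allOut-△⇒≡ (false ∷ v) (true  ∷ X) ()

allOut-△-self : (X : Subset m) → allOut (X △ X) ≡ true
allOut-△-self []          = refl
allOut-△-self (true  ∷ X) = allOut-△-self X
allOut-△-self (false ∷ X) = allOut-△-self X

allIn-△⇒≡∁ : (v X : Subset m) → allIn (v △ X) ≡ true → v ≡ ∁ X
allIn-△⇒≡∁ []          []          _ = refl
allIn-△⇒≡∁ (true  ∷ v) (false ∷ X) h = cong (true ∷_) (allIn-△⇒≡∁ v X h)
allIn-△⇒≡∁ (false ∷ v) (true  ∷ X) h = cong (false ∷_) (allIn-△⇒≡∁ v X h)
allIn-△⇒≡∁ (true  ∷ v) (true  ∷ X) ()
allIn-△⇒≡∁ (false ∷ v) (false ∷ X) ()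

allIn-∁△ : (X : Subset m) → allIn (∁ X △ X) ≡ true
allIn-∁△ []          = refl
allIn-∁△ (true  ∷ X) = allIn-∁△ X
allIn-∁△ (false ∷ X) = allIn-∁△ X

twist-Sys-enumerates : (X : Subset m) → Enumerates (twist (Sys m) X) (X ∷ ∁ X ∷ [])
twist-Sys-enumerates X v = mk⇔ to from
  where
  to : twist (Sys _) X v ≡ true → v ∈ˡ X ∷ ∁ X ∷ []
  to f with allOut (v △ X) in out
  ... | true  = here (allOut-△⇒≡ v X out)
  ... | false = there (here (allIn-△⇒≡∁ v X f))
  from : v ∈ˡ X ∷ ∁ X ∷ [] → twist (Sys _) X v ≡ true
  from (here refl)         = cong (_∨ allIn (X △ X)) (allOut-△-self X)
  from (there (here refl)) = trans (cong (allOut (∁ X △ X) ∨_) (allIn-∁△ X)) (∨-zeroʳ _)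

setBD setBC setCD : Subset 4
setBD = outside ∷ inside  ∷ outside ∷ inside  ∷ []
setBC = outside ∷ inside  ∷ inside  ∷ outside ∷ []
setCD = outside ∷ outside ∷ inside  ∷ inside  ∷ []

twist-T5-enumerates : Enumerates (twist T5 setAD) (setAD ∷ setBD ∷ setBC ∷ [])
twist-T5-enumerates v = mk⇔ (to v) from
  where
  to : ∀ v → twist T5 setAD v ≡ true → v ∈ˡ setAD ∷ setBD ∷ setBC ∷ []
  to (true  ∷ false ∷ false ∷ true  ∷ []) _ = here refl
  to (false ∷ true  ∷ false ∷ true  ∷ []) _ = there (here refl)
  to (false ∷ true  ∷ true  ∷ false ∷ []) _ = there (there (here refl))
  to (false ∷ false ∷ _     ∷ _     ∷ []) ()
  to (true  ∷ true  ∷ _     ∷ _     ∷ []) ()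
  to (true  ∷ false ∷ true  ∷ _     ∷ []) ()
  to (true  ∷ false ∷ false ∷ false ∷ []) ()
  to (false ∷ true  ∷ false ∷ false ∷ []) ()
  to (false ∷ true  ∷ true  ∷ true  ∷ []) ()
  from : v ∈ˡ setAD ∷ setBD ∷ setBC ∷ [] → twist T5 setAD v ≡ true
  from (here refl)                 = refl
  from (there (here refl))         = refl
  from (there (there (here refl))) = refl

twist-T6-enumerates : Enumerates (twist T6 setAD) (setAD ∷ setBD ∷ setBC ∷ setCD ∷ [])
twist-T6-enumerates v = mk⇔ (to v) from
  where
  to : ∀ v → twist T6 setAD v ≡ true → v ∈ˡ setAD ∷ setBD ∷ setBC ∷ setCD ∷ []
  to (true  ∷ false ∷ false ∷ true  ∷ []) _ = here refl
  to (false ∷ true  ∷ false ∷ true  ∷ []) _ = there (here refl)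
  to (false ∷ true  ∷ true  ∷ false ∷ []) _ = there (there (here refl))
  to (false ∷ false ∷ true  ∷ true  ∷ []) _ = there (there (there (here refl)))
  to (false ∷ false ∷ false ∷ _     ∷ []) ()
  to (false ∷ false ∷ true  ∷ false ∷ []) ()
  to (true  ∷ true  ∷ _     ∷ _     ∷ []) ()
  to (true  ∷ false ∷ true  ∷ _     ∷ []) ()
  to (true  ∷ false ∷ false ∷ false ∷ []) ()
  to (false ∷ true  ∷ false ∷ false ∷ []) ()
  to (false ∷ true  ∷ true  ∷ true  ∷ []) ()
  from : v ∈ˡ setAD ∷ setBD ∷ setBC ∷ setCD ∷ [] → twist T6 setAD v ≡ true
  from (here refl)                         = refl
  from (there (here refl))                 = refl
  from (there (there (here refl)))         = refl
  from (there (there (there (here refl)))) = refl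

isomorphic-excluded⇒hasExcludedMinor : {S : SetSystem n} {T : SetSystem m} → Excluded T → Isomorphic S T →
  HasExcludedMinor S
isomorphic-excluded⇒hasExcludedMinor excluded S≅T = _ , _ , _ , _ , here , excluded , S≅T

excluded-or-all-listed : (S : SetSystem n) (Cs : List (Subset n)) →
  (∀ K → Feasible S K → HasExcludedMinor S ⊎ K ∈ˡ Cs) →
  HasExcludedMinor S ⊎ (∀ K → Feasible S K → K ∈ˡ Cs)
excluded-or-all-listed S Cs listed
  with anySubset? (λ K → S K ≟ᵇ true ×-dec ¬? (Any.any? (K ≟ˢ_) Cs))
... | yes (K , fK , K∉Cs) = inj₁ ([ id , (λ K∈Cs → ⊥-elim (K∉Cs K∈Cs)) ]′ (listed K fK))
... | no none             = inj₂ λ K fK →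
  decidable-stable (Any.any? (K ≟ˢ_) Cs) (λ K∉Cs → none (K , fK , K∉Cs))

-- The basis exchange property

Exchangeable : SetSystem n → Subset n → Subset n → Fin n → Set
Exchangeable S A B x = ∃ λ y → lookup B y ≡ true × lookup A y ≡ false × Feasible S (exchange A x y)

BasisExchange : SetSystem n → Set
BasisExchange S = ∀ A B → Feasible S A → Feasible S B →
  ∀ x → lookup A x ≡ true → lookup B x ≡ false → Exchangeable S A B x

isMatroid⇒basisExchange : {S : SetSystem n} → IsMatroid S → BasisExchange S
isMatroid⇒basisExchange (_ , exch) A B fA fB x Ax Bx
  with exch A B fA fB x (lookup⇒[]= x A Ax) (λ x∈B → bool-absurd ([]=⇒lookup x∈B) Bx)
... | y , y∈B , y∉A , f = y , []=⇒lookup y∈B , ¬-not (y∉A ∘ lookup⇒[]= y A) , f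

basisExchange-pin : (S : SetSystem (suc n)) (e : Fin (suc n)) (b : Bool) →
  BasisExchange S → BasisExchange (pin S e b)
basisExchange-pin S e b exch A B fA fB x Ax Bx
  with exch (insertAt A e b) (insertAt B e b) fA fB (punchIn e x)
         (trans (insertAt-punchIn A e b x) Ax) (trans (insertAt-punchIn B e b x) Bx)
... | y , By , Ay , f = lower (punchInView e y) By Ay f
  where
  lower : ∀ {y} → PunchInView e y → lookup (insertAt B e b) y ≡ true → lookup (insertAt A e b) y ≡ false →
          S (exchange (insertAt A e b) (punchIn e x) y) ≡ true → Exchangeable (pin S e b) A B x
  lower at          By Ay _ = bool-absurd (trans (sym (insertAt-lookup B e b)) By) (trans (sym (insertAt-lookup A e b)) Ay)
  lower (punched j) By Ay f = j , trans (sym (insertAt-punchIn B e b j)) By , trans (sym (insertAt-punchIn A e b j)) Ay ,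
                              trans (cong S (insertAt-exchange A e b x j)) f

basisExchange-minor : {S : SetSystem n} {M : SetSystem m} → Minor S M → BasisExchange S → BasisExchange M
basisExchange-minor here                 exch = exch
basisExchange-minor {S = S} (con e _ S≼M) exch = basisExchange-minor S≼M (basisExchange-pin S e true exch)
basisExchange-minor {S = S} (del e _ S≼M) exch = basisExchange-minor S≼M (basisExchange-pin S e false exch)

basisExchange-isomorphic : {M : SetSystem n} {T : SetSystem m} → Isomorphic M T → BasisExchange M → BasisExchange T
basisExchange-isomorphic {n} {m} {M} {T} (φ , M≗T) exch A B fA fB x Ax Bx =
  push (exch (image ψ A) (image ψ B) (pull A fA) (pull B fB) (from x) (pull-x A Ax) (pull-x B Bx))
  where
  open Inverse φ using (to; from; strictlyInverseˡ)
  open ≡-Reasoning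
  ψ : Fin m ↔ Fin n
  ψ = ↔-sym φ

  pull : ∀ C → Feasible T C → Feasible M (image ψ C)
  pull C fC = trans (M≗T (image ψ C)) (trans (cong T (image-image⁻¹ φ C)) fC)

  pull-x : ∀ C {b} → lookup C x ≡ b → lookup (image ψ C) (from x) ≡ b
  pull-x C Cx = trans (lookup-image ψ C (from x)) (trans (cong (lookup C) (strictlyInverseˡ x)) Cx)

  push : Exchangeable M (image ψ A) (image ψ B) (from x) → Exchangeable T A B x
  push (y , By , Ay , f) = to y , trans (sym (lookup-image ψ B y)) By , trans (sym (lookup-image ψ A y)) Ay , (begin
    T (exchange A x (to y))                                  ≡⟨ cong (λ C → T (exchange C x (to y))) (image-image⁻¹ φ A) ⟨
    T (exchange (image φ (image ψ A)) x (to y))              ≡⟨ cong (λ z → T (exchange (image φ (image ψ A)) z (to y))) (strictlyInverseˡ x) ⟨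
    T (exchange (image φ (image ψ A)) (to (from x)) (to y))  ≡⟨ cong T (image-exchange φ (image ψ A) (from x) y) ⟨
    T (image φ (exchange (image ψ A) (from x) y))            ≡⟨ M≗T (exchange (image ψ A) (from x) y) ⟨
    M (exchange (image ψ A) (from x) y)                      ≡⟨ f ⟩
    true                                                     ∎)

-- In T5 * {a,d} and T6 * {a,d}, exchanging d out of {a,d} into {b,c} yields {a,b} or {a,c}; in
-- S_2k * X, exchanging the first element of X into ∁ X keeps the second one, as k ≥ 2.
¬basisExchange-excluded : {T : SetSystem m} → Excluded T → ¬ BasisExchange T
¬basisExchange-excluded exT5 exch with exch setAD setBC refl refl (suc (suc (suc zero))) refl refl
... | zero                , () , _
... | suc zero            , _  , _ , ()
... | suc (suc zero)      , _  , _ , ()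
... | suc (suc (suc zero)) , () , _
¬basisExchange-excluded exT6 exch with exch setAD setBC refl refl (suc (suc (suc zero))) refl refl
... | zero                , () , _
... | suc zero            , _  , _ , ()
... | suc (suc zero)      , _  , _ , ()
... | suc (suc (suc zero)) , () , _
¬basisExchange-excluded (exS (suc (suc k)) (s≤s (s≤s _))) exch
  with exch X (∁ X) (feasible (here refl)) (feasible (there (here refl))) zero refl refl
  where
  X : Subset (suc (suc k) + suc (suc k))
  X = firstHalf (suc (suc k))
  feasible : ∀ {v} → v ∈ˡ X ∷ ∁ X ∷ [] → twist (Sys _) X v ≡ true
  feasible {v} = Equivalence.from (twist-Sys-enumerates X v)
... | zero           , () , _
... | suc zero       , _  , () , _
... | suc (suc _)    , _  , _  , ()

hasExcludedMinor⇒¬basisExchange : {S : SetSystem n} → HasExcludedMinor S → ¬ BasisExchange S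
hasExcludedMinor⇒¬basisExchange (_ , _ , _ , _ , S≼M , excluded , M≅T) =
  ¬basisExchange-excluded excluded ∘ basisExchange-isomorphic M≅T ∘ basisExchange-minor S≼M

basisExchange⇒equicardinal : {S : SetSystem n} → BasisExchange S → Equicardinal S
basisExchange⇒equicardinal {S = S} exch A B fA fB = go _ A fA refl
  where
  go : ∀ d A → Feasible S A → ∣ A ─ B ∣ ≡ d → ∣ A ∣ ≡ ∣ B ∣
  go zero A fA A─B≡∅ = cong ∣_∣ (lookup-ext {u = A} {B} agree)
    where
    A⊆B : ∀ i → lookup A i ≡ true → lookup B i ≡ false → ⊥
    A⊆B i Ai Bi = bool-absurd (trans (lookup-─ A B i) (cong₂ (λ a b → a ∧ not b) Ai Bi)) (∣p∣≡0⇒∉ (A ─ B) A─B≡∅ i)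
    agree : ∀ i → lookup A i ≡ lookup B i
    agree i with lookup A i in Ai | lookup B i in Bi
    ... | true  | true  = refl
    ... | false | false = refl
    ... | true  | false = ⊥-elim (A⊆B i Ai Bi)
    ... | false | true  = let y , Ay , By , _ = exch B A fB fA i Bi Ai in ⊥-elim (A⊆B y Ay By)
  go (suc d) A fA A─B≡suc =
    let x , x∈A─B   = ∣p∣≡suc⇒∈ (A ─ B) A─B≡suc
        Ax , Bx     = ∧-not≡true (trans (sym (lookup-─ A B x)) x∈A─B)
        y , By , Ay , f = exch A B fA fB x Ax Bx
    in trans (sym (∣exchange∣ A Ax Ay))
             (go d (exchange A x y) f (cong pred (trans (sym (∣─∣-exchange A B Ax Bx By Ay)) A─B≡suc)))

-- Failures of basis exchange yield excluded minors

Stuck : SetSystem n → Subset n → Subset n → Fin n → Set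
Stuck S A B x = ∀ y → lookup B y ≡ true → lookup A y ≡ false → S (exchange A x y) ≡ false

exchangeable? : (S : SetSystem n) (A B : Subset n) (x : Fin n) → Exchangeable S A B x ⊎ Stuck S A B x
exchangeable? S A B x with any? (λ y → lookup B y ≟ᵇ true ×-dec lookup A y ≟ᵇ false ×-dec S (exchange A x y) ≟ᵇ true)
... | yes found = inj₁ found
... | no none   = inj₂ λ y By Ay → ¬-not λ fy → none (y , By , Ay , fy)

record ExchangeFailure (S : SetSystem n) : Set where
  constructor failure
  field
    {A B}      : Subset n
    {x}        : Fin n
    A-feasible : Feasible S A
    B-feasible : Feasible S B
    x∈A        : lookup A x ≡ true
    x∉B        : lookup B x ≡ false
    stuck      : Stuck S A B x

¬failure⇒isMatroid : {S : SetSystem n} → Proper S → ¬ ExchangeFailure S → IsMatroid S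
¬failure⇒isMatroid {S = S} proper noFailure = proper , exch
  where
  exch : ∀ A B → Feasible S A → Feasible S B → ∀ x → x ∈ A → x ∉ B →
         ∃ λ y → y ∈ B × y ∉ A × Feasible S ((A - x) ∪ ⁅ y ⁆)
  exch A B fA fB x x∈A x∉B with exchangeable? S A B x
  ... | inj₁ (y , By , Ay , f) = y , lookup⇒[]= y B By , (λ y∈A → bool-absurd ([]=⇒lookup y∈A) Ay) , f
  ... | inj₂ stuck = ⊥-elim (noFailure (failure fA fB ([]=⇒lookup x∈A) (¬-not (x∉B ∘ lookup⇒[]= x B)) stuck))

failure-pin : {S : SetSystem (suc n)} (f : ExchangeFailure S) (e : Fin (suc n)) →
  let open ExchangeFailure f in lookup A e ≡ lookup B e → ExchangeFailure (pin S e (lookup A e))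
failure-pin {n} {S} (failure {A} {B} {x} fA fB Ax Bx stuck) e Ae≡Be with punchInView e x
... | at         = bool-absurd Ax (trans Ae≡Be Bx)
... | punched x′ = failure (subst (Feasible S) (sym A′⁺) fA) (subst (Feasible S) (sym B′⁺) fB)
                     (lower A′⁺ Ax) (lower B′⁺ Bx) stuck′
  where
  b : Bool
  b = lookup A e
  A′ B′ : Subset n
  A′ = removeAt A e
  B′ = removeAt B e
  A′⁺ : insertAt A′ e b ≡ A
  A′⁺ = insertAt-removeAt A e
  B′⁺ : insertAt B′ e b ≡ B
  B′⁺ = trans (cong (insertAt B′ e) Ae≡Be) (insertAt-removeAt B e)
  lower : ∀ {C′ C j v} → insertAt C′ e b ≡ C → lookup C (punchIn e j) ≡ v → lookup C′ j ≡ v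
  lower {C′} {j = j} refl Cj = trans (sym (insertAt-punchIn C′ e b j)) Cj
  lift : ∀ {C′ C j v} → insertAt C′ e b ≡ C → lookup C′ j ≡ v → lookup C (punchIn e j) ≡ v
  lift {C′} {j = j} refl C′j = trans (insertAt-punchIn C′ e b j) C′j
  stuck′ : Stuck (pin S e b) A′ B′ x′
  stuck′ y B′y A′y = begin
    S (insertAt (exchange A′ x′ y) e b)                          ≡⟨ cong S (insertAt-exchange A′ e b x′ y) ⟩
    S (exchange (insertAt A′ e b) (punchIn e x′) (punchIn e y))  ≡⟨ cong (λ C → S (exchange C (punchIn e x′) (punchIn e y))) A′⁺ ⟩
    S (exchange A (punchIn e x′) (punchIn e y))                  ≡⟨ stuck (punchIn e y) (lift B′⁺ B′y) (lift A′⁺ A′y) ⟩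
    false                                                        ∎
    where open ≡-Reasoning

-- The induction hypothesis in the complementary case: a failure whose two sets agree at some
-- element survives in a smaller minor.
ExchangeOrExcluded : SetSystem n → Set
ExchangeOrExcluded S = ∀ {P Q z} → Feasible S P → Feasible S Q → lookup P z ≡ true → lookup Q z ≡ false →
  Agree P Q → HasExcludedMinor S ⊎ Exchangeable S P Q z

module Complementary {n : ℕ} {S : SetSystem n} (equi : Equicardinal S) (exchange-or-excluded : ExchangeOrExcluded S)
  {A B : Subset n} {x : Fin n} (fA : Feasible S A) (fB : Feasible S B) (Ax : lookup A x ≡ true)
  (stuck : Stuck S A B x) (B≗∁A : ∀ i → lookup B i ≡ not (lookup A i)) where

  Bx : lookup B x ≡ false
  Bx = trans (B≗∁A x) (cong not Ax)

  ∈B⇒∉A : ∀ {i} → lookup B i ≡ true → lookup A i ≡ false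
  ∈B⇒∉A {i} Bi = not-injective (trans (sym (B≗∁A i)) Bi)

  ∈A⇒∉B : ∀ {i} → lookup A i ≡ true → lookup B i ≡ false
  ∈A⇒∉B {i} Ai = trans (B≗∁A i) (cong not Ai)

  ∉A⇒∈B : ∀ {i} → lookup A i ≡ false → lookup B i ≡ true
  ∉A⇒∈B {i} Ai = trans (B≗∁A i) (cong not Ai)

  agree-with-A : ∀ {K} → K ≢ B → Agree A K
  agree-with-A {K} K≢B with agree-or-complement A K
  ... | inj₁ agree = agree
  ... | inj₂ K≗∁A  = ⊥-elim (K≢B (lookup-ext λ i → trans (K≗∁A i) (sym (B≗∁A i))))

  agree-with-B : ∀ {K} → K ≢ A → Agree K B
  agree-with-B {K} K≢A with agree-or-complement B K
  ... | inj₁ (e , Be≡Ke) = e , sym Be≡Ke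
  ... | inj₂ K≗∁B        = ⊥-elim (K≢A (lookup-ext λ i →
    trans (K≗∁B i) (trans (cong not (B≗∁A i)) (not-involutive (lookup A i)))))

  x∉feasible⇒excluded : ∀ {K} → Feasible S K → lookup K x ≡ false → K ≢ B → HasExcludedMinor S
  x∉feasible⇒excluded fK Kx K≢B with exchange-or-excluded fA fK Ax Kx (agree-with-A K≢B)
  ... | inj₁ excluded         = excluded
  ... | inj₂ (y , Ky , Ay , f) = bool-absurd f (stuck y (∉A⇒∈B Ay) Ay)

  -- A feasible set other than B that misses x contradicts stuck, so the exchange K - x + y towards B
  -- must give B itself.
  feasible⇒excluded-or-exchange : ∀ {K} → Feasible S K → K ≢ A → K ≢ B →
    HasExcludedMinor S ⊎ ∃ λ y → lookup B y ≡ true × K ≡ exchange B y x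
  feasible⇒excluded-or-exchange {K} fK K≢A K≢B with lookup K x in Kx
  ... | false = inj₁ (x∉feasible⇒excluded fK Kx K≢B)
  ... | true with exchange-or-excluded fK fB Kx Bx (agree-with-B K≢A)
  ...   | inj₁ excluded            = inj₁ excluded
  ...   | inj₂ (y , By , Ky , fK′) with exchange K x y ≟ˢ B
  ...     | no K′≢B  = inj₁ (x∉feasible⇒excluded fK′ (lookup-exchange-old K (≢-by-lookup {K = K} Kx Ky)) K′≢B)
  ...     | yes K′≡B = inj₂ (y , By , trans (sym (exchange-exchange K Kx Ky)) (cong (λ C → exchange C y x) K′≡B))

  -- If A = {x} then B = {y} for some y, and A - x + y = B would be feasible.
  A-x-nonempty : ∃ λ a → lookup (A - x) a ≡ true
  A-x-nonempty with ∣ A - x ∣ in ∣A-x∣≡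
  ... | suc _ = ∣p∣≡suc⇒∈ (A - x) ∣A-x∣≡
  ... | zero  = bool-absurd (subst (Feasible S) (sym A-x+y≡B) fB) (stuck y By (∈B⇒∉A By))
    where
    ∣B∣≡1 : ∣ B ∣ ≡ 1
    ∣B∣≡1 = trans (equi B A fB fA) (trans (∣p∣≡suc∣p-x∣ A Ax) (cong suc ∣A-x∣≡))
    y  = proj₁ (∣p∣≡suc⇒∈ B ∣B∣≡1)
    By = proj₂ (∣p∣≡suc⇒∈ B ∣B∣≡1)
    A-x+y≡B : exchange A x y ≡ B
    A-x+y≡B = lookup-ext pointwise
      where
      pointwise : ∀ i → lookup (exchange A x y) i ≡ lookup B i
      pointwise i with i ≟ x | i ≟ y
      ... | yes refl | _        = trans (lookup-exchange-old A (≢-by-lookup {K = B} By Bx ∘ sym)) (sym Bx)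
      ... | no _     | yes refl = trans (lookup-exchange-new A x i) (sym By)
      ... | no i≢x   | no i≢y   = begin
        lookup (exchange A x y) i ≡⟨ lookup-exchange-other A i≢x i≢y ⟩
        lookup A i                ≡⟨ lookup-remove-other A i≢x ⟨
        lookup (A - x) i          ≡⟨ ∣p∣≡0⇒∉ (A - x) ∣A-x∣≡ i ⟩
        false                     ≡⟨ ∣p∣≡0⇒∉ (B - y) (cong pred (trans (sym (∣p∣≡suc∣p-x∣ B By)) ∣B∣≡1)) i ⟨
        lookup (B - y) i          ≡⟨ lookup-remove-other B i≢y ⟩
        lookup B i                ∎
        where open ≡-Reasoning

  -- With (a, b, c, d) = (a, z, y, x): A = {a,d}, F = {b,d}, B = {b,c}, G = {c,d}, and these are
  -- the only candidates for feasible sets, so S is T5 * {a,d} or T6 * {a,d}.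
  module FourPoint {a z y : Fin n} (Aa : lookup A a ≡ true) (Bz : lookup B z ≡ true) (By : lookup B y ≡ true)
    (z≢y : z ≢ y) (a≢x : a ≢ x) (fF : Feasible S (exchange B y x))
    (cover : ∀ i → i ≡ a ⊎ i ≡ z ⊎ i ≡ y ⊎ i ≡ x) where

    F G : Subset n
    F = exchange B y x
    G = exchange B z x

    a≢z : a ≢ z
    a≢z = ≢-by-lookup {K = A} Aa (∈B⇒∉A Bz)
    a≢y : a ≢ y
    a≢y = ≢-by-lookup {K = A} Aa (∈B⇒∉A By)
    z≢x : z ≢ x
    z≢x = ≢-by-lookup {K = B} Bz Bx
    y≢x : y ≢ x
    y≢x = ≢-by-lookup {K = B} By Bx

    d : Fin 4 → Fin n
    d zero                   = a
    d (suc zero)             = z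
    d (suc (suc zero))       = y
    d (suc (suc (suc zero))) = x

    d-injective : ∀ {j k} → d j ≡ d k → j ≡ k
    d-injective {zero}                   {zero}                   _  = refl
    d-injective {zero}                   {suc zero}               eq = ⊥-elim (a≢z eq)
    d-injective {zero}                   {suc (suc zero)}         eq = ⊥-elim (a≢y eq)
    d-injective {zero}                   {suc (suc (suc zero))}   eq = ⊥-elim (a≢x eq)
    d-injective {suc zero}               {zero}                   eq = ⊥-elim (a≢z (sym eq))
    d-injective {suc zero}               {suc zero}               _  = refl
    d-injective {suc zero}               {suc (suc zero)}         eq = ⊥-elim (z≢y eq)
    d-injective {suc zero}               {suc (suc (suc zero))}   eq = ⊥-elim (z≢x eq)
    d-injective {suc (suc zero)}         {zero}                   eq = ⊥-elim (a≢y (sym eq))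
    d-injective {suc (suc zero)}         {suc zero}               eq = ⊥-elim (z≢y (sym eq))
    d-injective {suc (suc zero)}         {suc (suc zero)}         _  = refl
    d-injective {suc (suc zero)}         {suc (suc (suc zero))}   eq = ⊥-elim (y≢x eq)
    d-injective {suc (suc (suc zero))}   {zero}                   eq = ⊥-elim (a≢x (sym eq))
    d-injective {suc (suc (suc zero))}   {suc zero}               eq = ⊥-elim (z≢x (sym eq))
    d-injective {suc (suc (suc zero))}   {suc (suc zero)}         eq = ⊥-elim (y≢x (sym eq))
    d-injective {suc (suc (suc zero))}   {suc (suc (suc zero))}   _  = refl

    d-cover : ∀ i → ∃ λ j → d j ≡ i
    d-cover i with cover i
    ... | inj₁ refl                = zero , refl
    ... | inj₂ (inj₁ refl)         = suc zero , refl
    ... | inj₂ (inj₂ (inj₁ refl))  = suc (suc zero) , refl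
    ... | inj₂ (inj₂ (inj₂ refl))  = suc (suc (suc zero)) , refl

    φ : Fin n ↔ Fin 4
    φ = ↔-from-injective-cover d d-injective d-cover

    image-φ : ∀ K {va vz vy vx} → lookup K a ≡ va → lookup K z ≡ vz → lookup K y ≡ vy → lookup K x ≡ vx →
      image φ K ≡ va ∷ vz ∷ vy ∷ vx ∷ []
    image-φ K refl refl refl refl = refl

    φA : image φ A ≡ setAD
    φA = image-φ A Aa (∈B⇒∉A Bz) (∈B⇒∉A By) Ax

    φF : image φ F ≡ setBD
    φF = image-φ F (trans (lookup-exchange-other B a≢y a≢x) (∈A⇒∉B Aa))
                 (trans (lookup-exchange-other B z≢y z≢x) Bz)
                 (lookup-exchange-old B y≢x) (lookup-exchange-new B y x)

    φB : image φ B ≡ setBC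
    φB = image-φ B (∈A⇒∉B Aa) Bz By Bx

    φG : image φ G ≡ setCD
    φG = image-φ G (trans (lookup-exchange-other B a≢z a≢x) (∈A⇒∉B Aa))
                 (lookup-exchange-old B z≢x)
                 (trans (lookup-exchange-other B (z≢y ∘ sym) y≢x) By) (lookup-exchange-new B z x)

    listed : ∀ K → Feasible S K → HasExcludedMinor S ⊎ K ∈ˡ A ∷ F ∷ B ∷ G ∷ []
    listed K fK with K ≟ˢ A | K ≟ˢ B
    ... | yes K≡A | _       = inj₂ (here K≡A)
    ... | no _    | yes K≡B = inj₂ (there (there (here K≡B)))
    ... | no K≢A  | no K≢B  with feasible⇒excluded-or-exchange fK K≢A K≢B
    ...   | inj₁ excluded         = inj₁ excluded
    ...   | inj₂ (w , Bw , K≡) with cover w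
    ...     | inj₁ refl               = bool-absurd Bw (∈A⇒∉B Aa)
    ...     | inj₂ (inj₁ refl)        = inj₂ (there (there (there (here K≡))))
    ...     | inj₂ (inj₂ (inj₁ refl)) = inj₂ (there (here K≡))
    ...     | inj₂ (inj₂ (inj₂ refl)) = bool-absurd Bw Bx

    result : HasExcludedMinor S
    result with excluded-or-all-listed S (A ∷ F ∷ B ∷ G ∷ []) listed
    ... | inj₁ excluded   = excluded
    ... | inj₂ all-listed with S G in fG
    ...   | true  = isomorphic-excluded⇒hasExcludedMinor exT6
      (isomorphic-by-enumeration φ (A ∷ F ∷ B ∷ G ∷ []) (λ K → mk⇔ (all-listed K) feasible)
        (subst (Enumerates _) (sym (cong₂ _∷_ φA (cong₂ _∷_ φF (cong₂ _∷_ φB (cong₂ _∷_ φG refl))))) twist-T6-enumerates))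
      where
      feasible : ∀ {K} → K ∈ˡ A ∷ F ∷ B ∷ G ∷ [] → Feasible S K
      feasible (here refl)                         = fA
      feasible (there (here refl))                 = fF
      feasible (there (there (here refl)))         = fB
      feasible (there (there (there (here refl)))) = fG
    ...   | false = isomorphic-excluded⇒hasExcludedMinor exT5
      (isomorphic-by-enumeration φ (A ∷ F ∷ B ∷ []) (λ K → mk⇔ (listed-without-G K) feasible)
        (subst (Enumerates _) (sym (cong₂ _∷_ φA (cong₂ _∷_ φF (cong₂ _∷_ φB refl)))) twist-T5-enumerates))
      where
      listed-without-G : ∀ K → Feasible S K → K ∈ˡ A ∷ F ∷ B ∷ []
      listed-without-G K fK with all-listed K fK
      ... | here K≡A                         = here K≡A
      ... | there (here K≡F)                 = there (here K≡F)
      ... | there (there (here K≡B))         = there (there (here K≡B))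
      ... | there (there (there (here refl))) = bool-absurd fK fG
      feasible : ∀ {K} → K ∈ˡ A ∷ F ∷ B ∷ [] → Feasible S K
      feasible (here refl)                 = fA
      feasible (there (here refl))         = fF
      feasible (there (there (here refl))) = fB

  four-point : ∀ {a y} → lookup (A - x) a ≡ true → lookup B y ≡ true → Feasible S (exchange B y x) →
    HasExcludedMinor S
  four-point {a} {y} a∈A-x By fF =
    [ id , exchanged ]′ (exchange-or-excluded fA fF Aa Fa (x , trans Ax (sym (lookup-exchange-new B y x))))
    where
    F : Subset n
    F = exchange B y x
    Aa : lookup A a ≡ true
    Aa = proj₁ (lookup-remove⇒lookup A a∈A-x)
    a≢x : a ≢ x
    a≢x = proj₂ (lookup-remove⇒lookup A a∈A-x)
    y≢x : y ≢ x
    y≢x = ≢-by-lookup {K = B} By Bx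
    Fa : lookup F a ≡ false
    Fa = trans (lookup-exchange-other B (≢-by-lookup {K = A} Aa (∈B⇒∉A By)) a≢x) (∈A⇒∉B Aa)

    exchanged : Exchangeable S A F a → HasExcludedMinor S
    exchanged (z , Fz , Az , fH) = [ id , coincide ]′ (feasible⇒excluded-or-exchange fH H≢A H≢B)
      where
      H : Subset n
      H = exchange A a z
      z≢y : z ≢ y
      z≢y = ≢-by-lookup {K = F} Fz (lookup-exchange-old B y≢x)
      H≢A : H ≢ A
      H≢A H≡A = bool-absurd (trans (sym (cong (λ C → lookup C z) H≡A)) (lookup-exchange-new A a z)) Az
      H≢B : H ≢ B
      H≢B H≡B = bool-absurd
        (trans (sym (cong (λ C → lookup C x) H≡B))
               (trans (lookup-exchange-other A (a≢x ∘ sym) (≢-by-lookup {K = A} Ax Az)) Ax))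
        Bx

      coincide : ∃ (λ y′ → lookup B y′ ≡ true × H ≡ exchange B y′ x) → HasExcludedMinor S
      coincide (y′ , _ , H≡) = FourPoint.result Aa (∉A⇒∈B Az) By z≢y a≢x fF
        (subst (λ w → ∀ i → i ≡ a ⊎ i ≡ z ⊎ i ≡ w ⊎ i ≡ x) (sym y≡y′) cover)
        where
        cover : ∀ i → i ≡ a ⊎ i ≡ z ⊎ i ≡ y′ ⊎ i ≡ x
        cover = exchange-≡-cover B≗∁A H≡
        y≡y′ : y ≡ y′
        y≡y′ with cover y
        ... | inj₁ y≡a               = ⊥-elim (≢-by-lookup {K = A} Aa (∈B⇒∉A By) (sym y≡a))
        ... | inj₂ (inj₁ y≡z)        = ⊥-elim (z≢y (sym y≡z))
        ... | inj₂ (inj₂ (inj₁ y≡y′)) = y≡y′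
        ... | inj₂ (inj₂ (inj₂ y≡x)) = ⊥-elim (y≢x y≡x)

  two-point : Enumerates S (A ∷ B ∷ []) → 2 ≤ ∣ A ∣ → HasExcludedMinor S
  two-point enum 2≤∣A∣ =
    let π , πA≡half = partition-balanced A balanced
        πB≡∁half = trans (cong (image π) B≡∁A) (trans (image-∁ π A) (cong ∁ πA≡half))
    in isomorphic-excluded⇒hasExcludedMinor (exS ∣ A ∣ 2≤∣A∣)
         (isomorphic-by-enumeration π (A ∷ B ∷ []) enum
           (subst (Enumerates _) (sym (cong₂ _∷_ πA≡half (cong₂ _∷_ πB≡∁half refl)))
             (twist-Sys-enumerates (firstHalf ∣ A ∣))))
    where
    B≡∁A : B ≡ ∁ A
    B≡∁A = lookup-ext λ i → trans (B≗∁A i) (sym (lookup-map i not A))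
    balanced : ∣ ∁ A ∣ ≡ ∣ A ∣
    balanced = trans (cong ∣_∣ (sym B≡∁A)) (equi B A fB fA)

  listed-or-four-point : ∀ {a} → lookup (A - x) a ≡ true → ∀ K → Feasible S K → HasExcludedMinor S ⊎ K ∈ˡ A ∷ B ∷ []
  listed-or-four-point a∈A-x K fK with K ≟ˢ A | K ≟ˢ B
  ... | yes K≡A | _       = inj₂ (here K≡A)
  ... | no _    | yes K≡B = inj₂ (there (here K≡B))
  ... | no K≢A  | no K≢B  with feasible⇒excluded-or-exchange fK K≢A K≢B
  ...   | inj₁ excluded      = inj₁ excluded
  ...   | inj₂ (y , By , K≡F) = inj₁ (four-point a∈A-x By (subst (Feasible S) K≡F fK))

  result : HasExcludedMinor S
  result = let a , a∈A-x = A-x-nonempty in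
    [ id , (λ all-listed → two-point (λ K → mk⇔ (all-listed K) feasible) (2≤∣p∣ A Ax a∈A-x)) ]′
      (excluded-or-all-listed S (A ∷ B ∷ []) (listed-or-four-point a∈A-x))
    where
    feasible : ∀ {K} → K ∈ˡ A ∷ B ∷ [] → Feasible S K
    feasible (here refl)         = fA
    feasible (there (here refl)) = fB

failure⇒hasExcludedMinor : {S : SetSystem n} → Equicardinal S → ExchangeFailure S → HasExcludedMinor S
failure⇒hasExcludedMinor {zero}          _    (failure {x = ()} _ _ _ _ _)
failure⇒hasExcludedMinor {suc n} {S = S} equi (failure {A} {B} fA fB Ax Bx stuck) =
  [ via-pin (failure fA fB Ax Bx stuck) , Complementary.result equi exchange-or-excluded fA fB Ax stuck ]′
    (agree-or-complement A B)
  where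
  via-pin : (f : ExchangeFailure S) → Agree (ExchangeFailure.A f) (ExchangeFailure.B f) → HasExcludedMinor S
  via-pin f (e , Ae≡Be) = hasExcludedMinor-minor (minor-pin S e (ExchangeFailure.A-feasible f))
    (failure⇒hasExcludedMinor (equicardinal-pin S e _ equi) (failure-pin f e Ae≡Be))

  exchange-or-excluded : ExchangeOrExcluded S
  exchange-or-excluded {P} {Q} {z} fP fQ Pz Qz agree with exchangeable? S P Q z
  ... | inj₁ exchangeable = inj₂ exchangeable
  ... | inj₂ stuck′       = inj₁ (via-pin (failure fP fQ Pz Qz stuck′) agree)

corollary5p4 : (n : ℕ) (S : SetSystem n) → Proper S →
    (IsMatroid S ⇔ (Equicardinal S × ¬ HasExcludedMinor S))
corollary5p4 n S proper = mk⇔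
  (λ matroid → let exch = isMatroid⇒basisExchange matroid in
     basisExchange⇒equicardinal exch , λ excluded → hasExcludedMinor⇒¬basisExchange excluded exch)
  (λ (equi , noExcluded) → ¬failure⇒isMatroid proper (noExcluded ∘ failure⇒hasExcludedMinor equi))
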